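{- Let $p$ be a prime, let $A=\{\mathbf a_1,\dots,\mathbf a_N\}\subseteq\mathbb Z^n$, and let $\beta\in\mathbb Z^n$. Let $\gamma\in(\beta+p\mathbb Z^n)\cap\mathbb NA$ be such that $w(\gamma)\le w(\gamma')$ for all $\gamma'\in(\beta+p\mathbb Z^n)\cap\mathbb NA$. Then $\gamma$ is good.
   Context: $\mathbb N=\{0,1,2,\dots\}$ and $\mathbb NA=\{\sum_{i=1}^N c_i\mathbf a_i : c_i\in\mathbb N\}$. For $\beta\in\mathbb NA$ put $U^+(\beta)=\{u=(u_1,\dots,u_N)\in\mathbb N^N : \sum_{i=1}^N u_i\mathbf a_i=\beta\}$ and, for an integer $k\ge 0$, $U^+_k(\beta)=\{u\in U^+(\beta): u_i\le k \text{ for all } i\}$. The weight of $\beta$ is $w(\beta)=\min\{\sum_{i=1}^N u_i : u\in U^+(\beta)\}$, and $U^+_{\min}(\beta)=\{u\in U^+(\beta):\sum_i u_i=w(\beta)\}$. An element $\beta\in\mathbb NA$ is called good if $U^+_{\min}(\beta)\subseteq U^+_{p-1}(\beta)$, i.e. every $u\in U^+_{\min}(\beta)$ has all coordinates $\le p-1$. -}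

module Defs where

open import Data.Nat as ℕ using (ℕ; _≤_; _∸_)
open import Data.Integer as ℤ using (ℤ)
open import Data.Fin using (Fin)
open import Data.Vec using (Vec; replicate; zipWith)
open import Data.Vec.Functional using () renaming (foldr to ffoldr)
open import Data.Product using (Σ; ∃; _×_; _,_)
open import Relation.Binary.PropositionalEquality using (_≡_)

_⊕_ : ∀ {n} → Vec ℤ n → Vec ℤ n → Vec ℤ n
_⊕_ = zipWith ℤ._+_

scale : ∀ {n} → ℤ → Vec ℤ n → Vec ℤ n
scale c v = Data.Vec.map (c ℤ.*_) v

combo : ∀ {n N} → (Fin N → Vec ℤ n) → (Fin N → ℕ) → Vec ℤ n
combo {n} a u = ffoldr (λ i acc → scale (ℤ.+ (u i)) (a i) ⊕ acc) (replicate n (ℤ.+ 0)) (λ i → i)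

total : ∀ {N} → (Fin N → ℕ) → ℕ
total u = ffoldr (λ i acc → u i ℕ.+ acc) 0 (λ i → i)

U⁺ : ∀ {n N} → (Fin N → Vec ℤ n) → Vec ℤ n → (Fin N → ℕ) → Set
U⁺ a β u = combo a u ≡ β

InNA : ∀ {n N} → (Fin N → Vec ℤ n) → Vec ℤ n → Set
InNA a β = ∃ λ u → U⁺ a β u

IsWeight : ∀ {n N} → (Fin N → Vec ℤ n) → Vec ℤ n → ℕ → Set
IsWeight a β k = (∃ λ u → U⁺ a β u × total u ≡ k)
               × (∀ u → U⁺ a β u → k ≤ total u)

U⁺min : ∀ {n N} → (Fin N → Vec ℤ n) → Vec ℤ n → (Fin N → ℕ) → Set
U⁺min a β u = U⁺ a β u × (∀ k → IsWeight a β k → total u ≡ k)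

-- β is good (for the prime p): U⁺_min(β) ⊆ U⁺_{p-1}(β)
Good : ∀ {n N} → ℕ → (Fin N → Vec ℤ n) → Vec ℤ n → Set
Good p a β = ∀ u → U⁺min a β u → ∀ i → u i ≤ p ∸ 1

InCoset : ∀ {n} → ℕ → Vec ℤ n → Vec ℤ n → Set
InCoset {n} p β γ = ∃ λ (v : Vec ℤ n) → γ ≡ β ⊕ scale (ℤ.+ p) v

-- If a minimal representation u of γ had some coordinate u i ≥ p, then
-- γ' = γ − p·a_i lies in the same class β + pℤⁿ and is represented by u with
-- p removed from its i-th coordinate, so w(γ') ≤ |u| − p < |u| = w(γ),
-- contradicting the minimality of w(γ) on that class.  The weights exist only
-- classically (least element of a nonempty subset of ℕ); since the goal
-- u i ≤ p − 1 is decidable, it suffices to have them under a double negation.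
module Submission where

open import Defs
open import Data.Nat using (ℕ; zero; suc; _≤_; _<_; _≤?_; _∸_)
open import Data.Nat.Primality using (Prime; ¬prime[0])
open import Data.Integer using (ℤ)
open import Data.Fin using (Fin)
open import Data.Vec using (Vec)
open import Data.Product using (_×_)

import Data.Nat as ℕ
import Data.Nat.Properties as ℕ
import Data.Integer as ℤ
import Data.Integer.Properties as ℤ
open import Data.Nat.Induction using (<-wellFounded)
open import Data.Integer.Tactic.RingSolver using (solve-∀)
open import Data.Fin using (suc)
open import Data.Vec using ([]; _∷_; replicate)
open import Data.Vec.Functional using (updateAt) renaming (foldr to ffoldr)
open import Data.Vec.Properties using (zipWith-assoc)
open import Data.Product using (∃; _,_; proj₂)
open import Data.Empty using (⊥-elim)
open import Function using (_∘_; _on_)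
open import Induction.WellFounded using (Acc; acc)
open import Relation.Binary.Construct.On using (wellFounded)
open import Relation.Nullary using (¬_; yes; no)
open import Relation.Binary.PropositionalEquality

ffoldr-∘ : ∀ {A B C : Set} {n} (f : A → B → B) (z : B) (g : C → A) (h : Fin n → C) →
           ffoldr f z (g ∘ h) ≡ ffoldr (f ∘ g) z h
ffoldr-∘ {n = zero}  f z g h = refl
ffoldr-∘ {n = suc n} f z g h = cong (f (g (h Fin.zero))) (ffoldr-∘ f z g (h ∘ suc))

combo-suc : ∀ {n N} (a : Fin (suc N) → Vec ℤ n) (u : Fin (suc N) → ℕ) →
            combo a u ≡ scale (ℤ.+ u Fin.zero) (a Fin.zero) ⊕ combo (a ∘ suc) (u ∘ suc)
combo-suc {n} a u = cong (scale (ℤ.+ u Fin.zero) (a Fin.zero) ⊕_)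
  (ffoldr-∘ (λ i acc → scale (ℤ.+ u i) (a i) ⊕ acc) (replicate n (ℤ.+ 0)) suc (λ i → i))

total-suc : ∀ {N} (u : Fin (suc N) → ℕ) → total u ≡ u Fin.zero ℕ.+ total (u ∘ suc)
total-suc u = cong (u Fin.zero ℕ.+_) (ffoldr-∘ (λ i acc → u i ℕ.+ acc) 0 suc (λ i → i))

⊕-assoc : ∀ {n} (x y z : Vec ℤ n) → (x ⊕ y) ⊕ z ≡ x ⊕ (y ⊕ z)
⊕-assoc = zipWith-assoc ℤ.+-assoc

scale-+-⊕ : ∀ {n} (k l : ℤ) (x r : Vec ℤ n) →
            scale (k ℤ.+ l) x ⊕ r ≡ (scale k x ⊕ r) ⊕ scale l x
scale-+-⊕ k l []       []       = refl
scale-+-⊕ k l (x ∷ xs) (r ∷ rs) = cong₂ _∷_ (pointwise k l x r) (scale-+-⊕ k l xs rs)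
  where
  pointwise : ∀ k l x r → (k ℤ.+ l) ℤ.* x ℤ.+ r ≡ (k ℤ.* x ℤ.+ r) ℤ.+ l ℤ.* x
  pointwise = solve-∀

⊕-scale-cancel : ∀ {n} (q : ℤ) (x y b v : Vec ℤ n) → x ⊕ scale q y ≡ b ⊕ scale q v →
                 x ≡ b ⊕ scale q (v ⊕ scale (ℤ.- ℤ.+ 1) y)
⊕-scale-cancel q []       []       []       []       e = refl
⊕-scale-cancel q (x ∷ xs) (y ∷ ys) (b ∷ bs) (v ∷ vs) e =
  cong₂ _∷_ (pointwise x y b v (cong Data.Vec.head e))
            (⊕-scale-cancel q xs ys bs vs (cong Data.Vec.tail e))
  where
  pointwise : ∀ x y b v → x ℤ.+ q ℤ.* y ≡ b ℤ.+ q ℤ.* v →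
              x ≡ b ℤ.+ q ℤ.* (v ℤ.+ (ℤ.- ℤ.+ 1) ℤ.* y)
  pointwise x y b v e = begin
    x                                         ≡⟨ x≡ x q y ⟩
    (x ℤ.+ q ℤ.* y) ℤ.- q ℤ.* y               ≡⟨ cong (ℤ._- q ℤ.* y) e ⟩
    (b ℤ.+ q ℤ.* v) ℤ.- q ℤ.* y               ≡⟨ ≡b b q v y ⟩
    b ℤ.+ q ℤ.* (v ℤ.+ (ℤ.- ℤ.+ 1) ℤ.* y)     ∎
    where
    open ≡-Reasoning
    x≡ : ∀ x q y → x ≡ (x ℤ.+ q ℤ.* y) ℤ.- q ℤ.* y
    x≡ = solve-∀
    ≡b : ∀ b q v y → (b ℤ.+ q ℤ.* v) ℤ.- q ℤ.* y ≡ b ℤ.+ q ℤ.* (v ℤ.+ (ℤ.- ℤ.+ 1) ℤ.* y)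
    ≡b = solve-∀

InCoset-⊕-scale⁻ : ∀ {n} (p : ℕ) (β γ x : Vec ℤ n) →
                   InCoset p β (γ ⊕ scale (ℤ.+ p) x) → InCoset p β γ
InCoset-⊕-scale⁻ p β γ x (v , e) = _ , ⊕-scale-cancel (ℤ.+ p) γ x β v e

combo-updateAt-∸ : ∀ {n N} (p : ℕ) (a : Fin N → Vec ℤ n) (u : Fin N → ℕ) i → p ≤ u i →
                   combo a u ≡ combo a (updateAt u i (_∸ p)) ⊕ scale (ℤ.+ p) (a i)
combo-updateAt-∸ {N = suc N} p a u Fin.zero p≤u₀ = begin
  combo a u                                                 ≡⟨ combo-suc a u ⟩
  scale (ℤ.+ u₀) a₀ ⊕ rest                                  ≡⟨ cong (λ m → scale (ℤ.+ m) a₀ ⊕ rest)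
                                                                    (sym (ℕ.m∸n+n≡m p≤u₀)) ⟩
  scale (ℤ.+ (u₀ ∸ p) ℤ.+ ℤ.+ p) a₀ ⊕ rest                  ≡⟨ scale-+-⊕ (ℤ.+ (u₀ ∸ p)) (ℤ.+ p) a₀ rest ⟩
  (scale (ℤ.+ (u₀ ∸ p)) a₀ ⊕ rest) ⊕ scale (ℤ.+ p) a₀       ≡⟨ cong (_⊕ scale (ℤ.+ p) a₀)
                                                                    (sym (combo-suc a (updateAt u Fin.zero (_∸ p)))) ⟩
  combo a (updateAt u Fin.zero (_∸ p)) ⊕ scale (ℤ.+ p) a₀   ∎
  where
  open ≡-Reasoning
  u₀ = u Fin.zero
  a₀ = a Fin.zero
  rest = combo (a ∘ suc) (u ∘ suc)
combo-updateAt-∸ {N = suc N} p a u (suc i) p≤uᵢ = begin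
  combo a u                                                  ≡⟨ combo-suc a u ⟩
  term₀ ⊕ combo (a ∘ suc) (u ∘ suc)                          ≡⟨ cong (term₀ ⊕_)
                                                                     (combo-updateAt-∸ p (a ∘ suc) (u ∘ suc) i p≤uᵢ) ⟩
  term₀ ⊕ (combo (a ∘ suc) u' ⊕ removed)                     ≡⟨ sym (⊕-assoc term₀ _ removed) ⟩
  (term₀ ⊕ combo (a ∘ suc) u') ⊕ removed                     ≡⟨ cong (_⊕ removed)
                                                                     (sym (combo-suc a (updateAt u (suc i) (_∸ p)))) ⟩
  combo a (updateAt u (suc i) (_∸ p)) ⊕ removed              ∎
  where
  open ≡-Reasoning
  term₀ = scale (ℤ.+ u Fin.zero) (a Fin.zero)
  u' = updateAt (u ∘ suc) i (_∸ p)
  removed = scale (ℤ.+ p) (a (suc i))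

total-updateAt-∸ : ∀ {N} (p : ℕ) (u : Fin N → ℕ) i → p ≤ u i →
                   total u ≡ total (updateAt u i (_∸ p)) ℕ.+ p
total-updateAt-∸ {suc N} p u Fin.zero p≤u₀ = begin
  total u                          ≡⟨ total-suc u ⟩
  u₀ ℕ.+ rest                      ≡⟨ cong (ℕ._+ rest) (sym (ℕ.m∸n+n≡m p≤u₀)) ⟩
  (u₀ ∸ p) ℕ.+ p ℕ.+ rest          ≡⟨ ℕ.+-assoc (u₀ ∸ p) p rest ⟩
  (u₀ ∸ p) ℕ.+ (p ℕ.+ rest)        ≡⟨ cong ((u₀ ∸ p) ℕ.+_) (ℕ.+-comm p rest) ⟩
  (u₀ ∸ p) ℕ.+ (rest ℕ.+ p)        ≡⟨ sym (ℕ.+-assoc (u₀ ∸ p) rest p) ⟩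
  (u₀ ∸ p) ℕ.+ rest ℕ.+ p          ≡⟨ cong (ℕ._+ p) (sym (total-suc (updateAt u Fin.zero (_∸ p)))) ⟩
  total (updateAt u Fin.zero (_∸ p)) ℕ.+ p ∎
  where
  open ≡-Reasoning
  u₀ = u Fin.zero
  rest = total (u ∘ suc)
total-updateAt-∸ {suc N} p u (suc i) p≤uᵢ = begin
  total u                                      ≡⟨ total-suc u ⟩
  u Fin.zero ℕ.+ total (u ∘ suc)               ≡⟨ cong (u Fin.zero ℕ.+_) (total-updateAt-∸ p (u ∘ suc) i p≤uᵢ) ⟩
  u Fin.zero ℕ.+ (total u' ℕ.+ p)              ≡⟨ sym (ℕ.+-assoc (u Fin.zero) (total u') p) ⟩
  u Fin.zero ℕ.+ total u' ℕ.+ p                ≡⟨ cong (ℕ._+ p) (sym (total-suc (updateAt u (suc i) (_∸ p)))) ⟩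
  total (updateAt u (suc i) (_∸ p)) ℕ.+ p      ∎
  where
  open ≡-Reasoning
  u' = updateAt (u ∘ suc) i (_∸ p)

-- Least-number principle under double negation: a refutation of the minimality
-- of x produces a witness with smaller measure, to which the refutation applies again.
¬¬-minimal : ∀ {A : Set} (f : A → ℕ) {P : A → Set} {x : A} → P x →
             ¬ ¬ ∃ λ y → P y × (∀ z → P z → f y ≤ f z)
¬¬-minimal f {P} {x} Px = go x (wellFounded f <-wellFounded x) Px
  where
  go : ∀ x → Acc (_<_ on f) x → P x → ¬ ¬ ∃ λ y → P y × (∀ z → P z → f y ≤ f z)
  go x (acc rs) Px ¬min = ¬min (x , Px , λ z Pz → ℕ.≮⇒≥ (λ fz<fx → go z (rs fz<fx) Pz ¬min))

¬¬-weight : ∀ {n N} (a : Fin N → Vec ℤ n) (β : Vec ℤ n) → InNA a β → ¬ ¬ ∃ (IsWeight a β)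
¬¬-weight a β (u , uβ) ¬w =
  ¬¬-minimal total {U⁺ a β} {u} uβ λ { (v , vβ , min) → ¬w (total v , (v , vβ , refl) , min) }

minimal-weight-in-coset⇒good :
  ∀ {n N} (q : ℕ) (a : Fin N → Vec ℤ n) (β γ : Vec ℤ n) → InCoset (suc q) β γ →
  (∀ γ' → InCoset (suc q) β γ' → InNA a γ' → ∀ w w' → IsWeight a γ w → IsWeight a γ' w' → w ≤ w') →
  Good (suc q) a γ
minimal-weight-in-coset⇒good q a β γ γ∈β+pℤⁿ minimal u (uγ , u-min) i with u i ≤? q
... | yes uᵢ≤q = uᵢ≤q
... | no  uᵢ≰q =
  ⊥-elim (¬¬-weight a γ (u , uγ) λ { (w , wγ) →
          ¬¬-weight a γ' (u' , refl) λ { (w' , wγ') →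
          ℕ.<-irrefl refl (lighter w wγ w' wγ') } })
  where
  p = suc q
  p≤uᵢ : p ≤ u i
  p≤uᵢ = ℕ.≰⇒> uᵢ≰q
  u' = updateAt u i (_∸ p)
  γ' = combo a u'
  γ'∈β+pℤⁿ : InCoset p β γ'
  γ'∈β+pℤⁿ = InCoset-⊕-scale⁻ p β γ' (a i)
    (subst (InCoset p β) (trans (sym uγ) (combo-updateAt-∸ p a u i p≤uᵢ)) γ∈β+pℤⁿ)
  lighter : ∀ w → IsWeight a γ w → ∀ w' → IsWeight a γ' w' → w < w
  lighter w wγ w' wγ' = begin-strict
    w                   ≤⟨ minimal γ' γ'∈β+pℤⁿ (u' , refl) w w' wγ wγ' ⟩
    w'                  ≤⟨ proj₂ wγ' u' refl ⟩
    total u'            <⟨ ℕ.m<m+n (total u') ℕ.z<s ⟩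
    total u' ℕ.+ p      ≡⟨ sym (total-updateAt-∸ p u i p≤uᵢ) ⟩
    total u             ≡⟨ u-min w wγ ⟩
    w                   ∎
    where open ℕ.≤-Reasoning

lemma2p6 : (p : ℕ) → Prime p → (n N : ℕ) → (a : Fin N → Vec ℤ n) → (β γ : Vec ℤ n)
    → InCoset p β γ → InNA a γ
    → (∀ γ' → InCoset p β γ' → InNA a γ' → ∀ w w' → IsWeight a γ w → IsWeight a γ' w' → w ≤ w')
    → Good p a γ
lemma2p6 zero    prime[0] = ⊥-elim (¬prime[0] prime[0])
lemma2p6 (suc q) _ n N a β γ γ∈β+pℤⁿ _ = minimal-weight-in-coset⇒good q a β γ γ∈β+pℤⁿ
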